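{- Let $k,r,q,m$ be integers such that $k\ge 5$, $r\ge 1$, $q\ge 24r+12$ is a multiple of $4$, and $m>18r+2$. Then for every vertex $v$ of $G_{k,m,q}$, the graph $G_{k,m,q}-v$ is $(k-1)$-colorable.
   Context: For integers $a\le b$, $[a,b]=\{a,a+1,\ldots,b\}$, and for $A\subseteq\mathbb{Z}$, $c\in\mathbb{Z}$, $A+c=\{a+c: a\in A\}$. For $N\in\mathbb{N}$ and $a,b\in[0,N-1]$, $d_N(a,b)=\min\{|b-a|,N-|b-a|\}$. For positive integers $k,m$ let $n_{k,m}=(k-1)m$ if $k$ is odd and $n_{k,m}=2(k-1)m$ if $k$ is even. For positive integers $k,m,q$ with $q$ even, $G_{k,m,q}$ is the graph with vertices $v_0,\ldots,v_{N-1}$, where $N=qn_{k,m}+1$, in which $v_i$ and $v_j$ are adjacent iff $d_N(i,j)\in D_1\cup D_2\cup D_3$, where $D_1=\{1,3,\ldots,2m-1\}$; $D_2=\bigcup_{q'=0}^{q/2-1}\bigl([2m,(k-3)m+1]+q'n_{k,m}\bigr)$ if $k$ is odd and $D_2=\bigcup_{q'=0}^{q/2-1}\bigl([2m,(k-4)m+2]+q'n_{k,m}\bigr)$ if $k$ is even; $D_3=\emptyset$ if $k$ is odd and $D_3=\bigcup_{q'=0}^{q/2-1}\bigl([(k+2)m-1,(2k-4)m+1]+q'n_{k,m}\bigr)$ if $k$ is even. $G-v$ denotes the graph obtained by deleting $v$. -}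

module Defs where

open import Data.Nat using (ℕ; zero; suc; _+_; _*_; _∸_; _≤_; _<_; _⊔_; _⊓_; ∣_-_∣)
open import Data.Nat.DivMod using (_%_; _/_)
open import Data.Bool using (Bool; true; false; if_then_else_)
open import Data.Nat using (_≡ᵇ_)
open import Data.Product using (Σ; _×_; ∃-syntax)
open import Data.Sum using (_⊎_)
open import Data.Fin using (Fin)
open import Relation.Binary.PropositionalEquality using (_≡_; _≢_)

isOdd : ℕ → Bool
isOdd k = (k % 2) ≡ᵇ 1

nkm : ℕ → ℕ → ℕ
nkm k m = if isOdd k then (k ∸ 1) * m else 2 * ((k ∸ 1) * m)

Nv : ℕ → ℕ → ℕ → ℕ
Nv k m q = q * nkm k m + 1

dist : ℕ → ℕ → ℕ → ℕ
dist N a b = ∣ a - b ∣ ⊓ (N ∸ ∣ a - b ∣)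

InRange : ℕ → ℕ → ℕ → Set
InRange lo hi d = lo ≤ d × d ≤ hi

InD1 : ℕ → ℕ → Set
InD1 m d = ∃[ t ] (t < m × d ≡ 2 * t + 1)

d2hi : ℕ → ℕ → ℕ
d2hi k m = if isOdd k then (k ∸ 3) * m + 1 else (k ∸ 4) * m + 2

InD2 : ℕ → ℕ → ℕ → ℕ → Set
InD2 k m q d = ∃[ q' ] (q' < q / 2 × InRange (2 * m + q' * nkm k m) (d2hi k m + q' * nkm k m) d)

InD3 : ℕ → ℕ → ℕ → ℕ → Set
InD3 k m q d with isOdd k
... | true  = Fin 0
... | false = ∃[ q' ] (q' < q / 2 × InRange ((k + 2) * m ∸ 1 + q' * nkm k m) ((2 * k ∸ 4) * m + 1 + q' * nkm k m) d)

Adj : ℕ → ℕ → ℕ → ℕ → ℕ → Set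
Adj k m q i j = let d = dist (Nv k m q) i j in InD1 m d ⊎ InD2 k m q d ⊎ InD3 k m q d

ColorableMinus : ℕ → ℕ → ℕ → ℕ → ℕ → Set
ColorableMinus c k m q v =
  Σ (ℕ → Fin c) λ col → ∀ i j → i < Nv k m q → j < Nv k m q → i ≢ v → j ≢ v →
    Adj k m q i j → col i ≢ col j

{-# OPTIONS --safe #-}
-- Write n = n_{k,m} and N = q n + 1.  Rotating ℤ_N so that the deleted vertex becomes N − 1 turns
-- G − v into a graph on the path 0, …, N − 2 in which i < j are adjacent iff j − i or N − (j − i)
-- lies in D = D₁ ∪ D₂ ∪ D₃.  Colour i by a colour κ (i mod n) of its residue.  Modulo n, D₂ and D₃
-- become a few intervals of residues and D₁ is the odd numbers below 2m, so it suffices that for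
-- κ p = κ p' the residues of p' − p and p + 1 − p' avoid those intervals, p' − p is not odd below
-- 2m, and p' − p is small enough that no short chord of D₁ wraps around the cycle.
--
-- Cut the residues into blocks of 2m consecutive numbers and each block into its even and its odd
-- half.  For odd k there are k − 1 half-blocks, each with its own colour, so equally coloured
-- residues differ by an even number below 2m.  For even k there are 2 (k − 1) half-blocks; the even
-- half of block w and the odd half of block w + (k − 2)/2 (mod k − 1) share a colour, and their
-- differences fall strictly between the residue intervals of D₂ and D₃.
module Submission where

open import Data.Bool using (true; false)
open import Data.Empty using (⊥-elim)
open import Data.Fin using (Fin; toℕ)
open import Data.Fin.Properties using (toℕ-fromℕ<)
open import Data.Nat hiding (parity)
open import Data.Nat.DivMod
open import Data.Nat.Divisibility using (_∣_; m∣m*n)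
open import Data.Nat.Properties
open import Data.Nat.Tactic.RingSolver using (solve-∀)
open import Data.Product using (Σ; ∃-syntax; _×_; _,_; proj₁; proj₂)
open import Data.Sum using (_⊎_; inj₁; inj₂; [_,_])
open import Function using (_∘_)
open import Relation.Binary.Construct.Closure.Symmetric using (SymClosure; fwd; bwd; symmetric)
open import Relation.Binary.Definitions using (tri<; tri≈; tri>)
open import Relation.Binary.PropositionalEquality hiding ([_])
open import Relation.Nullary using (¬_; yes; no)

open import Defs

DeletedCirculantColouring : (K N : ℕ) (D : ℕ → Set) (v : ℕ) → Set
DeletedCirculantColouring K N D v =
  Σ (ℕ → Fin K) λ col → ∀ x y → x < N → y < N → x ≢ v → y ≢ v → D (dist N x y) → col x ≢ col y

-- On ℤ_N, vertices i < j are joined by arcs of lengths j ∸ i and N ∸ (j ∸ i).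
ProperOnPath : (K N : ℕ) (D : ℕ → Set) → (ℕ → Fin K) → Set
ProperOnPath K N D c =
  ∀ i j → i < j → suc j < N → c i ≡ c j → ¬ D (j ∸ i) × ¬ D (N ∸ (j ∸ i))

dist-comm : ∀ N x y → dist N x y ≡ dist N y x
dist-comm N x y = cong (λ a → a ⊓ (N ∸ a)) (∣-∣-comm x y)

dist-self : ∀ N x → dist N x x ≡ 0
dist-self N x = cong (λ a → a ⊓ (N ∸ a)) (∣n-n∣≡0 x)

dist-ordered : ∀ N {i j} → i ≤ j → dist N i j ≡ (j ∸ i) ⊓ (N ∸ (j ∸ i))
dist-ordered N i≤j = cong (λ a → a ⊓ (N ∸ a)) (m≤n⇒∣m-n∣≡n∸m i≤j)

dist-cong : ∀ N x y x' y' → ∣ x - y ∣ ≡ ∣ x' - y' ∣ ⊎ ∣ x - y ∣ + ∣ x' - y' ∣ ≡ N →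
            dist N x y ≡ dist N x' y'
dist-cong N x y x' y' (inj₁ eq) = cong (λ a → a ⊓ (N ∸ a)) eq
dist-cong N x y x' y' (inj₂ eq) = begin
  a ⊓ (N ∸ a)        ≡⟨ cong (a ⊓_) (trans (cong (_∸ a) (sym eq)) (m+n∸m≡n a b)) ⟩
  a ⊓ b              ≡⟨ ⊓-comm a b ⟩
  b ⊓ a              ≡⟨ cong (b ⊓_) (trans (cong (_∸ b) (sym eq)) (m+n∸n≡m a b)) ⟨
  b ⊓ (N ∸ b)        ∎
  where
  open ≡-Reasoning
  a = ∣ x - y ∣
  b = ∣ x' - y' ∣

module Rotation {N v : ℕ} (v<N : v < N) where

  private instance
    N≢0 : NonZero N
    N≢0 = >-nonZero (≤-<-trans z≤n v<N)

  C : ℕ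
  C = N ∸ suc v

  N≡1+v+C : N ≡ suc v + C
  N≡1+v+C = sym (m+[n∸m]≡n v<N)

  rotate : ℕ → ℕ
  rotate x = (x + C) % N

  data RotateView (x : ℕ) : Set where
    above : ∀ i → x ≡ suc v + i → rotate x ≡ i → RotateView x
    below : x < v → rotate x ≡ x + C → RotateView x

  rotateView : ∀ {x} → x < N → x ≢ v → RotateView x
  rotateView {x} x<N x≢v with v <? x
  ... | yes v<x = above i x≡ (begin
        (x + C) % N           ≡⟨ cong (λ y → (y + C) % N) x≡ ⟩
        (suc v + i + C) % N   ≡⟨ cong (_% N) (trans (+-comm (suc v + i) C) (solve v i C)) ⟩
        (i + (suc v + C)) % N ≡⟨ cong (λ y → (i + y) % N) N≡1+v+C ⟨
        (i + N) % N           ≡⟨ [m+n]%n≡m%n i N ⟩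
        i % N                 ≡⟨ m<n⇒m%n≡m i<N ⟩
        i                     ∎)
    where
    open ≡-Reasoning
    i = x ∸ suc v
    x≡ : x ≡ suc v + i
    x≡ = sym (m+[n∸m]≡n v<x)
    i<N : i < N
    i<N = ≤-<-trans (m∸n≤m x (suc v)) x<N
    solve : ∀ v i C → C + (suc v + i) ≡ i + (suc v + C)
    solve = solve-∀
  ... | no v≮x = below x<v (m<n⇒m%n≡m (subst (x + C <_) (sym N≡1+v+C) (+-monoˡ-< C (m<n⇒m<1+n x<v))))
    where x<v = ≤∧≢⇒< (≮⇒≥ v≮x) x≢v

  rotate-< : ∀ {x} → x < N → x ≢ v → suc (rotate x) < N
  rotate-< x<N x≢v with rotateView x<N x≢v
  ... | above i refl ri rewrite ri = ≤-trans (s≤s (s≤s (m≤n+m i v))) x<N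
  ... | below x<v rx rewrite rx = subst (suc (suc (_ + C)) ≤_) (sym N≡1+v+C) (+-monoˡ-≤ C (s≤s x<v))

  private
    gap-mixed : ∀ {x y i} → x < N → x ≡ suc v + i → y < v → ∣ x - y ∣ + ∣ i - (y + C) ∣ ≡ N
    gap-mixed {x} {y} {i} x<N refl y<v = begin
      ∣ x - y ∣ + ∣ i - (y + C) ∣         ≡⟨ cong₂ (λ a b → ∣ a - y ∣ + ∣ i - b ∣) x≡ y+C≡ ⟩
      ∣ y + (2 + s + i) - y ∣ + ∣ i - i + (y + suc t) ∣
                                          ≡⟨ cong₂ _+_ (trans (∣-∣-comm _ y) (∣m-m+n∣≡n y _)) (∣m-m+n∣≡n i _) ⟩
      (2 + s + i) + (y + suc t)           ≡⟨ solve-N y s i t ⟩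
      suc (suc (y + s)) + suc (i + t)     ≡⟨ cong₂ (λ a b → suc a + b) v≡ C≡ ⟨
      suc v + C                           ≡⟨ N≡1+v+C ⟨
      N                                   ∎
      where
      open ≡-Reasoning
      s = proj₁ (m≤n⇒∃[o]m+o≡n y<v)
      v≡ : v ≡ suc (y + s)
      v≡ = sym (proj₂ (m≤n⇒∃[o]m+o≡n y<v))
      i<C : i < C
      i<C = +-cancelˡ-< (suc v) i C (subst (suc v + i <_) N≡1+v+C x<N)
      t = proj₁ (m≤n⇒∃[o]m+o≡n i<C)
      C≡ : C ≡ suc (i + t)
      C≡ = sym (proj₂ (m≤n⇒∃[o]m+o≡n i<C))
      x≡ : suc v + i ≡ y + (2 + s + i)
      x≡ = trans (cong (λ w → suc w + i) v≡) (solve-x y s i)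
        where solve-x : ∀ y s i → suc (suc (y + s)) + i ≡ y + (2 + s + i)
              solve-x = solve-∀
      y+C≡ : y + C ≡ i + (y + suc t)
      y+C≡ = trans (cong (y +_) C≡) (solve-y y i t)
        where solve-y : ∀ y i t → y + suc (i + t) ≡ i + (y + suc t)
              solve-y = solve-∀
      solve-N : ∀ y s i t → (2 + s + i) + (y + suc t) ≡ suc (suc (y + s)) + suc (i + t)
      solve-N = solve-∀

  dist-rotate : ∀ {x y} → x < N → y < N → x ≢ v → y ≢ v → dist N x y ≡ dist N (rotate x) (rotate y)
  dist-rotate {x} {y} x<N y<N x≢v y≢v = dist-cong N x y (rotate x) (rotate y) (gap (rotateView x<N x≢v) (rotateView y<N y≢v))
    where
    gap : RotateView x → RotateView y →
          ∣ x - y ∣ ≡ ∣ rotate x - rotate y ∣ ⊎ ∣ x - y ∣ + ∣ rotate x - rotate y ∣ ≡ N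
    gap (above i refl ri) (above j refl rj) rewrite ri | rj = inj₁ (∣m+n-m+o∣≡∣n-o∣ (suc v) i j)
    gap (below _ rx) (below _ ry) rewrite rx | ry | +-comm x C | +-comm y C = inj₁ (sym (∣m+n-m+o∣≡∣n-o∣ C x y))
    gap (above i x≡ ri) (below y<v ry) rewrite ri | ry = inj₂ (gap-mixed x<N x≡ y<v)
    gap (below x<v rx) (above j y≡ rj) rewrite rx | rj =
      inj₂ (subst₂ (λ a b → a + b ≡ N) (∣-∣-comm y x) (∣-∣-comm j (x + C)) (gap-mixed y<N y≡ x<v))

deleted-circulant-colouring : ∀ {K N D c v} → ¬ D 0 → ProperOnPath K N D c → v < N →
                              DeletedCirculantColouring K N D v
deleted-circulant-colouring {K} {N} {D} {c} {v} ¬D0 proper v<N = c ∘ rotate , proper′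
  where
  open Rotation v<N
  ordered : ∀ {x y} → x < N → y < N → x ≢ v → y ≢ v → rotate x < rotate y →
            D (dist N x y) → c (rotate x) ≢ c (rotate y)
  ordered {x} {y} x<N y<N x≢v y≢v lt Dxy same =
    [ (λ eq → proj₁ on-path (subst D (trans d≡ eq) Dxy)) , (λ eq → proj₂ on-path (subst D (trans d≡ eq) Dxy)) ]
      (⊓-sel (rotate y ∸ rotate x) (N ∸ (rotate y ∸ rotate x)))
    where
    on-path = proper _ _ lt (rotate-< y<N y≢v) same
    d≡ : dist N x y ≡ (rotate y ∸ rotate x) ⊓ (N ∸ (rotate y ∸ rotate x))
    d≡ = trans (dist-rotate x<N y<N x≢v y≢v) (dist-ordered N (<⇒≤ lt))
  proper′ : ∀ x y → x < N → y < N → x ≢ v → y ≢ v → D (dist N x y) → c (rotate x) ≢ c (rotate y)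
  proper′ x y x<N y<N x≢v y≢v Dxy with <-cmp (rotate x) (rotate y)
  ... | tri< lt _ _ = ordered x<N y<N x≢v y≢v lt Dxy
  ... | tri> _ _ gt = ordered y<N x<N y≢v x≢v gt (subst D (dist-comm N x y) Dxy) ∘ sym
  ... | tri≈ _ eq _ = λ _ → ¬D0 (subst D d≡0 Dxy)
    where d≡0 = trans (dist-rotate x<N y<N x≢v y≢v) (trans (cong (dist N (rotate x)) (sym eq)) (dist-self N (rotate x)))

-- r ≡ b − a (mod n); faithful for a, r < n and b ≤ n
DiffMod : ℕ → ℕ → ℕ → ℕ → Set
DiffMod n a b r = a + r ≡ b ⊎ a + r ≡ b + n

DiffMod-cancelˡ : ∀ {n a b r} z → DiffMod n (z + a) (z + b) r → DiffMod n a b r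
DiffMod-cancelˡ {n} {a} {b} {r} z (inj₁ eq) = inj₁ (+-cancelˡ-≡ z _ _ (trans (sym (+-assoc z a r)) eq))
DiffMod-cancelˡ {n} {a} {b} {r} z (inj₂ eq) =
  inj₂ (+-cancelˡ-≡ z _ _ (trans (sym (+-assoc z a r)) (trans eq (+-assoc z b n))))

odd≢0 : ∀ t → 2 * t + 1 ≢ 0
odd≢0 t eq = 1+n≢0 (trans (+-comm 1 (2 * t)) eq)

InD1-< : ∀ {m d} → InD1 m d → d < 2 * m
InD1-< {m} (t , t<m , refl) = subst (_≤ 2 * m) (solve t) (*-monoʳ-≤ 2 t<m)
  where solve : ∀ t → 2 * suc t ≡ suc (2 * t + 1)
        solve = solve-∀

+-cancelʳ-shift : ∀ {a b c n} → a + c ≡ b + c + n → a ≡ b + n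
+-cancelʳ-shift {a} {b} {c} {n} e = +-cancelʳ-≡ c a (b + n) (trans e (solve b c n))
  where solve : ∀ b c n → b + c + n ≡ b + n + c
        solve = solve-∀

module _ {n : ℕ} .{{_ : NonZero n}} where

  <2n-cases : ∀ {x} → x < n + n → x ≡ x % n ⊎ x ≡ x % n + n
  <2n-cases {x} x<2n with x <? n
  ... | yes x<n = inj₁ (sym (m<n⇒m%n≡m x<n))
  ... | no x≮n = inj₂ (begin
      x               ≡⟨ m∸n+n≡m n≤x ⟨
      x ∸ n + n       ≡⟨ cong (_+ n) (m<n⇒m%n≡m x∸n<n) ⟨
      (x ∸ n) % n + n ≡⟨ cong (_+ n) (m≤n⇒[n∸m]%m≡n%m n≤x) ⟩
      x % n + n       ∎)
    where
    open ≡-Reasoning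
    n≤x = ≮⇒≥ x≮n
    x∸n<n : x ∸ n < n
    x∸n<n = +-cancelʳ-< n (x ∸ n) n (subst (_< n + n) (sym (m∸n+n≡m n≤x)) x<2n)

  %-equal-cases : ∀ {x y} → x < n + n → y < n + n → x % n ≡ y % n → x ≡ y ⊎ x ≡ y + n ⊎ y ≡ x + n
  %-equal-cases {x} {y} x<2n y<2n eq with <2n-cases x<2n | <2n-cases y<2n
  ... | inj₁ ex | inj₁ ey = inj₁ (trans ex (trans eq (sym ey)))
  ... | inj₂ ex | inj₂ ey = inj₁ (trans ex (trans (cong (_+ n) eq) (sym ey)))
  ... | inj₂ ex | inj₁ ey = inj₂ (inj₁ (trans ex (cong (_+ n) (trans eq (sym ey)))))
  ... | inj₁ ex | inj₂ ey = inj₂ (inj₂ (trans ey (cong (_+ n) (trans (sym eq) (sym ex)))))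

  +-%-cancelʳ : ∀ {w w' c} → w < n → w' < n → w + c < n + n → w' + c < n + n →
                (w + c) % n ≡ (w' + c) % n → w ≡ w'
  +-%-cancelʳ {w} {w'} {c} w<n w'<n bound bound' eq with %-equal-cases bound bound' eq
  ... | inj₁ e = +-cancelʳ-≡ c w w' e
  ... | inj₂ (inj₁ e) = ⊥-elim (<⇒≱ w<n (m+n≤o⇒n≤o w' (≤-reflexive (sym (+-cancelʳ-shift {b = w'} {n = n} e)))))
  ... | inj₂ (inj₂ e) = ⊥-elim (<⇒≱ w'<n (m+n≤o⇒n≤o w (≤-reflexive (sym (+-cancelʳ-shift {b = w} {n = n} e)))))

  mod≡⇒%≡ : ∀ {x y} → x mod n ≡ y mod n → x % n ≡ y % n
  mod≡⇒%≡ {x} {y} eq = begin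
    x % n         ≡⟨ toℕ-fromℕ< (m%n<n x n) ⟨
    toℕ (x mod n) ≡⟨ cong toℕ eq ⟩
    toℕ (y mod n) ≡⟨ toℕ-fromℕ< (m%n<n y n) ⟩
    y % n         ∎
    where open ≡-Reasoning

  mod-injective-< : ∀ {x y} → x < n → y < n → x mod n ≡ y mod n → x ≡ y
  mod-injective-< {x} {y} x<n y<n eq = trans (sym (m<n⇒m%n≡m x<n)) (trans (mod≡⇒%≡ eq) (m<n⇒m%n≡m y<n))

  InRange-% : ∀ {lo hi d} Q → hi < n → InRange (lo + Q * n) (hi + Q * n) d → InRange lo hi (d % n)
  InRange-% {lo} {hi} {d} Q hi<n (lo≤d , d≤hi) = subst (InRange lo hi) (sym d%n) (lo≤x , x≤hi)
    where
    x = d ∸ Q * n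
    x+Qn : x + Q * n ≡ d
    x+Qn = m∸n+n≡m (m+n≤o⇒n≤o lo lo≤d)
    lo≤x : lo ≤ x
    lo≤x = +-cancelʳ-≤ (Q * n) lo x (subst (lo + Q * n ≤_) (sym x+Qn) lo≤d)
    x≤hi : x ≤ hi
    x≤hi = +-cancelʳ-≤ (Q * n) x hi (subst (_≤ hi + Q * n) (sym x+Qn) d≤hi)
    d%n : d % n ≡ x
    d%n = trans (cong (_% n) (sym x+Qn)) (trans ([m+kn]%n≡m%n x Q n) (m<n⇒m%n≡m (≤-<-trans x≤hi hi<n)))

  suc-% : ∀ i → suc i % n ≡ suc (i % n) % n
  suc-% i = begin
    (1 + i) % n             ≡⟨ %-distribˡ-+ 1 i n ⟩
    (1 % n + i % n) % n     ≡⟨ cong (λ z → (1 % n + z) % n) (m%n%n≡m%n i n) ⟨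
    (1 % n + i % n % n) % n ≡⟨ %-distribˡ-+ 1 (i % n) n ⟨
    (1 + i % n) % n         ∎
    where open ≡-Reasoning

  DiffMod-% : ∀ {a b r} → r < n → a < n → b ≤ n → (a + r) % n ≡ b % n → DiffMod n a b r ⊎ (r ≡ 0 × b ≡ n)
  DiffMod-% {a} {b} {r} r<n a<n b≤n eq with %-equal-cases (+-mono-< a<n r<n) (≤-<-trans b≤n (m<m+n n (>-nonZero⁻¹ n))) eq
  ... | inj₁ e = inj₁ (inj₁ e)
  ... | inj₂ (inj₁ e) = inj₁ (inj₂ e)
  ... | inj₂ (inj₂ e) = inj₂ (m+n≡0⇒n≡0 a a+r≡0 , trans e (cong (_+ n) a+r≡0))
    where
    a+r≡0 : a + r ≡ 0
    a+r≡0 = n≤0⇒n≡0 (+-cancelʳ-≤ n (a + r) 0 (subst (_≤ n) e b≤n))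

module Periodic {K : ℕ} (n : ℕ) .{{_ : NonZero n}} (m q : ℕ) (κ : ℕ → Fin K) (D R : ℕ → Set)
  (2m≤n : 2 * m ≤ n)
  (D-residue : ∀ d → D d → InD1 m d ⊎ R (d % n))
  (¬R0 : ¬ R 0)
  (diff-safe : ∀ {p p' r} → p < n → p' < n → κ p ≡ κ p' → r < n → DiffMod n p p' r → ¬ R r × ¬ InD1 m r)
  (codiff-safe : ∀ {p p' r} → p < n → p' < n → κ p ≡ κ p' → r < n → DiffMod n p' (suc p) r → ¬ R r)
  (span : ∀ {p p'} → p < n → p' < n → κ p ≡ κ p' → p' + 2 * m ≤ p + n + 1)
  where

  ¬D0 : ¬ D 0
  ¬D0 D0 with D-residue 0 D0
  ... | inj₁ (t , _ , eq) = odd≢0 t (sym eq)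
  ... | inj₂ R0 = ¬R0 (subst R (m<n⇒m%n≡m (>-nonZero⁻¹ n)) R0)

  ¬D-gap : ∀ {i j} → i < j → κ (i % n) ≡ κ (j % n) → ¬ D (j ∸ i)
  ¬D-gap {i} {j} i<j same Dδ = [ ¬odd , proj₁ safe ] (D-residue δ Dδ)
    where
    open ≡-Reasoning
    δ = j ∸ i
    residues : (i % n + δ % n) % n ≡ j % n % n
    residues = begin
      (i % n + δ % n) % n ≡⟨ %-distribˡ-+ i δ n ⟨
      (i + δ) % n         ≡⟨ cong (_% n) (m+[n∸m]≡n (<⇒≤ i<j)) ⟩
      j % n               ≡⟨ m%n%n≡m%n j n ⟨
      j % n % n           ∎
    diff : DiffMod n (i % n) (j % n) (δ % n)
    diff with DiffMod-% (m%n<n δ n) (m%n<n i n) (<⇒≤ (m%n<n j n)) residues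
    ... | inj₁ d = d
    ... | inj₂ (_ , j%n≡n) = ⊥-elim (<-irrefl j%n≡n (m%n<n j n))
    safe = diff-safe (m%n<n i n) (m%n<n j n) same (m%n<n δ n) diff
    ¬odd : ¬ InD1 m δ
    ¬odd odd = proj₂ safe (subst (InD1 m) (sym (m<n⇒m%n≡m (<-≤-trans (InD1-< odd) 2m≤n))) odd)

  wrap-bound : ∀ {i j e} → j < q * n → j + e ≡ suc i + q * n → suc (i + n) ≤ j % n + e
  wrap-bound {i} {j} {e} j<qn j+e = +-cancelʳ-≤ Jn (suc (i + n)) (j % n + e) (begin
    suc (i + n) + Jn  ≡⟨ +-assoc (suc i) n Jn ⟩
    suc i + (n + Jn)  ≤⟨ +-monoʳ-≤ (suc i) (*-monoˡ-≤ n {suc (j / n)} {q} (m<n*o⇒m/o<n j<qn)) ⟩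
    suc i + q * n     ≡⟨ j+e ⟨
    j + e             ≡⟨ cong (_+ e) (m≡m%n+[m/n]*n j n) ⟩
    j % n + Jn + e    ≡⟨ +-assoc (j % n) Jn e ⟩
    j % n + (Jn + e)  ≡⟨ cong (j % n +_) (+-comm Jn e) ⟩
    j % n + (e + Jn)  ≡⟨ +-assoc (j % n) e Jn ⟨
    j % n + e + Jn    ∎)
    where
    open ≤-Reasoning
    Jn = j / n * n

  ¬D-cogap : ∀ {i j} → i < j → j < q * n → κ (i % n) ≡ κ (j % n) → ¬ D (q * n + 1 ∸ (j ∸ i))
  ¬D-cogap {i} {j} i<j j<qn same De = [ ¬short , ¬res ] (D-residue e De)
    where
    δ = j ∸ i
    e = q * n + 1 ∸ δ
    j+e : j + e ≡ suc i + q * n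
    j+e = begin
      j + e           ≡⟨ cong (_+ e) (m+[n∸m]≡n (<⇒≤ i<j)) ⟨
      i + δ + e       ≡⟨ +-assoc i δ e ⟩
      i + (δ + e)     ≡⟨ cong (i +_) (m+[n∸m]≡n δ≤N) ⟩
      i + (q * n + 1) ≡⟨ solve i (q * n) ⟩
      suc i + q * n   ∎
      where
      open ≡-Reasoning
      solve : ∀ i x → i + (x + 1) ≡ suc i + x
      solve = solve-∀
      δ≤N : δ ≤ q * n + 1
      δ≤N = ≤-trans (m∸n≤m j i) (≤-trans (<⇒≤ j<qn) (m≤m+n (q * n) 1))
    residues : (j % n + e % n) % n ≡ suc (i % n) % n
    residues = begin
      (j % n + e % n) % n ≡⟨ %-distribˡ-+ j e n ⟨
      (j + e) % n         ≡⟨ cong (_% n) j+e ⟩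
      (suc i + q * n) % n ≡⟨ [m+kn]%n≡m%n (suc i) q n ⟩
      suc i % n           ≡⟨ suc-% i ⟩
      suc (i % n) % n     ∎
      where open ≡-Reasoning
    ¬res : ¬ R (e % n)
    ¬res res with DiffMod-% (m%n<n e n) (m%n<n j n) (m%n<n i n) residues
    ... | inj₁ diff = codiff-safe (m%n<n i n) (m%n<n j n) same (m%n<n e n) diff res
    ... | inj₂ (r≡0 , _) = ¬R0 (subst R r≡0 res)
    -- a chord of D₁ across the cut N − 1 | 0 puts i and j % n further apart than any colour class
    ¬short : ¬ InD1 m e
    ¬short odd = <-irrefl refl (<-≤-trans long (≤-trans (span (m%n<n i n) (m%n<n j n) same) (≤-reflexive i+n+1)))
      where
      long : suc (i + n) < j % n + 2 * m
      long = ≤-<-trans (wrap-bound j<qn j+e) (+-monoʳ-< (j % n) (InD1-< odd))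
      i<n : i < n
      i<n = <-≤-trans (+-cancelʳ-< n i (2 * m) (begin-strict
        i + n           <⟨ <-trans (n<1+n (i + n)) long ⟩
        j % n + 2 * m   <⟨ +-monoˡ-< (2 * m) (m%n<n j n) ⟩
        n + 2 * m       ≡⟨ +-comm n (2 * m) ⟩
        2 * m + n       ∎)) 2m≤n
        where open ≤-Reasoning
      i+n+1 : i % n + n + 1 ≡ suc (i + n)
      i+n+1 = trans (cong (λ z → z + n + 1) (m<n⇒m%n≡m i<n)) (+-comm (i + n) 1)

  periodic-proper : ProperOnPath K (q * n + 1) D (λ i → κ (i % n))
  periodic-proper i j i<j j+1<N same = ¬D-gap i<j same , ¬D-cogap i<j j<qn same
    where
    j<qn : j < q * n
    j<qn = +-cancelʳ-< 1 j (q * n) (subst (_≤ q * n + 1) (+-comm 1 (suc j)) j+1<N)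

Near : ℕ → ℕ → ℕ → Set
Near m p p' = ∃[ e ] e < m × p' ≡ p + 2 * e

Across : ℕ → ℕ → ℕ → ℕ → Set
Across lo hi p p' = ∃[ x ] lo ≤ x × x < hi × p' ≡ p + x

-- r ≡ x (mod n) for some integer x with 2 − 2m ≤ x < 2m
NearZero : ℕ → ℕ → ℕ → Set
NearZero m n r = r < 2 * m ⊎ n + 2 ≤ r + 2 * m

2*e+2≤2*m : ∀ {e m} → e < m → 2 * e + 2 ≤ 2 * m
2*e+2≤2*m {e} {m} e<m = subst (_≤ 2 * m) (solve e) (*-monoʳ-≤ 2 e<m)
  where solve : ∀ e → 2 * suc e ≡ 2 * e + 2
        solve = solve-∀

2*m≤4*m : ∀ m → 2 * m ≤ 4 * m
2*m≤4*m m = *-monoˡ-≤ m {2} {4} (s≤s (s≤s z≤n))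

1+2*e<2*m : ∀ {e m} → e < m → suc (2 * e) < 2 * m
1+2*e<2*m {e} {m} e<m = subst (_≤ 2 * m) (+-comm (2 * e) 2) (2*e+2≤2*m e<m)

InRange⇒¬NearZero : ∀ {m n a b r} → 2 * m ≤ a → b + 2 * m ≤ n + 1 → InRange a b r → ¬ NearZero m n r
InRange⇒¬NearZero 2m≤a _ (a≤r , _) (inj₁ r<2m) = <⇒≱ r<2m (≤-trans 2m≤a a≤r)
InRange⇒¬NearZero {m} {n} {b = b} {r} _ b+2m≤n+1 (_ , r≤b) (inj₂ wraps) = 1+n≰n (begin
  suc (n + 1) ≡⟨ +-suc n 1 ⟨
  n + 2       ≤⟨ wraps ⟩
  r + 2 * m   ≤⟨ +-monoˡ-≤ (2 * m) r≤b ⟩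
  b + 2 * m   ≤⟨ b+2m≤n+1 ⟩
  n + 1       ∎)
  where open ≤-Reasoning

Across-intro : ∀ {lo hi p p'} → p + lo ≤ p' → p' < p + hi → Across lo hi p p'
Across-intro {lo} {hi} {p} p+lo≤p' p'<p+hi with m≤n⇒∃[o]m+o≡n (m+n≤o⇒m≤o p p+lo≤p')
... | x , refl = x , +-cancelˡ-≤ p lo x p+lo≤p' , +-cancelˡ-< p x hi p'<p+hi , refl

module _ {m n : ℕ} where

  near-diff : 4 * m ≤ n → ∀ {p p' r} → r < n → SymClosure (Near m) p p' → DiffMod n p p' r →
              NearZero m n r × ¬ InD1 m r
  near-diff 4m≤n {p} {r = r} r<n (fwd (e , e<m , refl)) d
    with DiffMod-cancelˡ p (subst (λ a → DiffMod n a (p + 2 * e) r) (sym (+-identityʳ p)) d)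
  ... | inj₁ refl = inj₁ (*-monoʳ-< 2 e<m) , λ (t , _ , 2e≡) → even≢odd e t (trans 2e≡ (+-comm (2 * t) 1))
  ... | inj₂ refl = ⊥-elim (<⇒≱ r<n (m≤n+m n (2 * e)))
  near-diff 4m≤n {p' = p'} {r} r<n (bwd (e , e<m , refl)) d
    with DiffMod-cancelˡ p' (subst (λ b → DiffMod n (p' + 2 * e) b r) (sym (+-identityʳ p')) d)
  ... | inj₁ 2e+r≡0 rewrite m+n≡0⇒n≡0 (2 * e) 2e+r≡0 =
        inj₁ (≤-<-trans z≤n (*-monoʳ-< 2 e<m)) , λ (t , _ , 0≡) → odd≢0 t (sym 0≡)
  ... | inj₂ 2e+r≡n = inj₂ wraps , λ odd → <⇒≱ (short odd) 4m≤n
    where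
    open ≤-Reasoning
    wraps : n + 2 ≤ r + 2 * m
    wraps = begin
      n + 2         ≡⟨ cong (_+ 2) 2e+r≡n ⟨
      2 * e + r + 2 ≡⟨ solve (2 * e) r ⟩
      r + (2 * e + 2) ≤⟨ +-monoʳ-≤ r (2*e+2≤2*m e<m) ⟩
      r + 2 * m     ∎
      where solve : ∀ a r → a + r + 2 ≡ r + (a + 2)
            solve = solve-∀
    short : InD1 m r → n < 4 * m
    short odd = begin-strict
      n             ≡⟨ 2e+r≡n ⟨
      2 * e + r     <⟨ +-mono-< (*-monoʳ-< 2 e<m) (InD1-< odd) ⟩
      2 * m + 2 * m ≡⟨ solve m ⟩
      4 * m         ∎
      where solve : ∀ m → 2 * m + 2 * m ≡ 4 * m
            solve = solve-∀

  near-codiff : ∀ {p p' r} → r < n → SymClosure (Near m) p p' → DiffMod n p' (suc p) r → NearZero m n r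
  near-codiff {p} {r = r} r<n (fwd (e , e<m , refl)) d
    with DiffMod-cancelˡ p (subst (λ b → DiffMod n (p + 2 * e) b r) (+-comm 1 p) d)
  ... | inj₁ 2e+r≡1 = inj₁ (≤-<-trans (m+n≤o⇒n≤o (2 * e) (≤-reflexive 2e+r≡1)) (m+n≤o⇒n≤o (2 * e) (2*e+2≤2*m e<m)))
  ... | inj₂ 2e+r≡1+n = inj₂ (begin
      n + 2           ≡⟨ +-comm n 2 ⟩
      suc (suc n)     ≡⟨ cong suc 2e+r≡1+n ⟨
      suc (2 * e + r) ≡⟨ +-comm (suc (2 * e)) r ⟩
      r + suc (2 * e) ≤⟨ +-monoʳ-≤ r (<⇒≤ (1+2*e<2*m e<m)) ⟩
      r + 2 * m       ∎)
    where open ≤-Reasoning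
  near-codiff {p' = p'} {r} r<n (bwd (e , e<m , refl)) d
    with DiffMod-cancelˡ p' (subst₂ (λ a b → DiffMod n a b r) (sym (+-identityʳ p')) (sym (+-suc p' (2 * e))) d)
  ... | inj₁ refl = inj₁ (1+2*e<2*m e<m)
  ... | inj₂ refl = ⊥-elim (<⇒≱ r<n (m≤n+m n _))

  near-span : 4 * m ≤ n → ∀ {p p'} → SymClosure (Near m) p p' → p' + 2 * m ≤ p + n + 1
  near-span 4m≤n {p} (fwd (e , e<m , refl)) = begin
    p + 2 * e + 2 * m ≤⟨ +-monoˡ-≤ (2 * m) (+-monoʳ-≤ p (*-monoʳ-≤ 2 (<⇒≤ e<m))) ⟩
    p + 2 * m + 2 * m ≡⟨ solve p m ⟩
    p + 4 * m         ≤⟨ +-monoʳ-≤ p 4m≤n ⟩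
    p + n             ≤⟨ m≤m+n (p + n) 1 ⟩
    p + n + 1         ∎
    where
    open ≤-Reasoning
    solve : ∀ p m → p + 2 * m + 2 * m ≡ p + 4 * m
    solve = solve-∀
  near-span 4m≤n {p' = p'} (bwd (e , e<m , refl)) = begin
    p' + 2 * m          ≤⟨ +-monoʳ-≤ p' (≤-trans (2*m≤4*m m) 4m≤n) ⟩
    p' + n              ≤⟨ +-monoˡ-≤ n (m≤m+n p' (2 * e)) ⟩
    p' + 2 * e + n      ≤⟨ m≤m+n _ 1 ⟩
    p' + 2 * e + n + 1  ∎
    where open ≤-Reasoning

module _ {lo hi n : ℕ} (lo+hi≡1+n : lo + hi ≡ suc n) where

  x+lo≤n : ∀ {x} → x < hi → x + lo ≤ n
  x+lo≤n {x} x<hi = s≤s⁻¹ (subst (x + lo <_) lo+hi≡1+n (subst (_< lo + hi) (+-comm lo x) (+-monoʳ-< lo x<hi)))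

  across-diff : ∀ {p p' r} → r < n → SymClosure (Across lo hi) p p' → DiffMod n p p' r → InRange lo hi r
  across-diff {p} {r = r} r<n (fwd (x , lo≤x , x<hi , refl)) d
    with DiffMod-cancelˡ p (subst (λ a → DiffMod n a (p + x) r) (sym (+-identityʳ p)) d)
  ... | inj₁ refl = lo≤x , <⇒≤ x<hi
  ... | inj₂ refl = ⊥-elim (<⇒≱ r<n (m≤n+m n x))
  across-diff {p' = p'} {r} r<n (bwd (x , lo≤x , x<hi , refl)) d
    with DiffMod-cancelˡ p' (subst (λ b → DiffMod n (p' + x) b r) (sym (+-identityʳ p')) d)
  ... | inj₁ x+r≡0 rewrite m+n≡0⇒m≡0 x x+r≡0 | m+n≡0⇒n≡0 x x+r≡0 = lo≤x , z≤n
  ... | inj₂ x+r≡n = +-cancelˡ-≤ x lo r (begin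
        x + lo   ≤⟨ x+lo≤n x<hi ⟩
        n        ≡⟨ x+r≡n ⟨
        x + r    ∎)
      , <⇒≤ (+-cancelˡ-< x r hi (begin-strict
        x + r    ≡⟨ x+r≡n ⟩
        n        <⟨ n<1+n n ⟩
        suc n    ≡⟨ lo+hi≡1+n ⟨
        lo + hi  ≤⟨ +-monoˡ-≤ hi lo≤x ⟩
        x + hi   ∎))
    where open ≤-Reasoning

  across-codiff : 2 ≤ lo → ∀ {p p' r} → r < n → SymClosure (Across lo hi) p p' → DiffMod n p' (suc p) r →
                  InRange lo hi r
  across-codiff 2≤lo {p} {r = r} r<n (fwd (x , lo≤x , x<hi , refl)) d
    with DiffMod-cancelˡ p (subst (λ b → DiffMod n (p + x) b r) (+-comm 1 p) d)
  ... | inj₁ x+r≡1 = ⊥-elim (<⇒≱ (s≤s (≤-trans 2≤lo lo≤x)) (s≤s (m+n≤o⇒m≤o x (≤-reflexive x+r≡1))))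
  ... | inj₂ x+r≡1+n = <⇒≤ (+-cancelˡ-< x lo r (begin-strict
        x + lo   ≡⟨ +-comm x lo ⟩
        lo + x   <⟨ +-monoʳ-< lo x<hi ⟩
        lo + hi  ≡⟨ trans lo+hi≡1+n (sym x+r≡1+n) ⟩
        x + r    ∎))
      , +-cancelˡ-≤ x r hi (begin
        x + r    ≡⟨ trans x+r≡1+n (sym lo+hi≡1+n) ⟩
        lo + hi  ≤⟨ +-monoˡ-≤ hi lo≤x ⟩
        x + hi   ∎)
    where open ≤-Reasoning
  across-codiff 2≤lo {p' = p'} {r} r<n (bwd (x , lo≤x , x<hi , refl)) d
    with DiffMod-cancelˡ p' (subst₂ (λ a b → DiffMod n a b r) (sym (+-identityʳ p')) (sym (+-suc p' x)) d)
  ... | inj₁ refl = m≤n⇒m≤1+n lo≤x , x<hi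
  ... | inj₂ refl = ⊥-elim (<⇒≱ r<n (m≤n+m n _))

  across-span : ∀ {m p p'} → 2 * m ≤ lo → SymClosure (Across lo hi) p p' → p' + 2 * m ≤ p + n + 1
  across-span {m} {p} 2m≤lo (fwd (x , lo≤x , x<hi , refl)) = begin
    p + x + 2 * m     ≤⟨ +-monoʳ-≤ (p + x) 2m≤lo ⟩
    p + x + lo        ≡⟨ +-assoc p x lo ⟩
    p + (x + lo)      ≤⟨ +-monoʳ-≤ p (x+lo≤n x<hi) ⟩
    p + n             ≤⟨ m≤m+n (p + n) 1 ⟩
    p + n + 1         ∎
    where open ≤-Reasoning
  across-span {m} {p' = p'} 2m≤lo (bwd (x , lo≤x , x<hi , refl)) = begin
    p' + 2 * m        ≤⟨ +-monoʳ-≤ p' (≤-trans 2m≤lo lo≤x) ⟩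
    p' + x            ≤⟨ m≤m+n (p' + x) (n + 1) ⟩
    p' + x + (n + 1)  ≡⟨ +-assoc (p' + x) n 1 ⟨
    p' + x + n + 1    ∎
    where open ≤-Reasoning

module Blocks (m : ℕ) .{{_ : NonZero m}} where

  parity offset block : ℕ → ℕ
  parity p = p % 2
  offset p = p / 2 % m
  block p = p / 2 / m

  parity-<2 : ∀ p → parity p < 2
  parity-<2 p = m%n<n p 2

  offset-< : ∀ p → offset p < m
  offset-< p = m%n<n (p / 2) m

  decompose : ∀ p → p ≡ parity p + 2 * (offset p + block p * m)
  decompose p = trans (m≡m%n+[m/n]*n p 2)
    (cong (parity p +_) (trans (*-comm (p / 2) 2) (cong (2 *_) (m≡m%n+[m/n]*n (p / 2) m))))

  block-< : ∀ {p H} → p < 2 * (H * m) → block p < H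
  block-< {p} {H} p<2Hm = m<n*o⇒m/o<n (m<n*o⇒m/o<n (subst (p <_) (*-comm 2 (H * m)) p<2Hm))

  block-lower : ∀ p → parity p + 2 * (block p * m) ≤ p
  block-lower p = subst (parity p + 2 * (block p * m) ≤_) (sym (decompose p))
    (+-monoʳ-≤ (parity p) (*-monoʳ-≤ 2 (m≤n+m (block p * m) (offset p))))

  block-upper : ∀ p → 2 + p ≤ parity p + 2 * (suc (block p) * m)
  block-upper p = begin
    2 + p                                         ≡⟨ cong (2 +_) (decompose p) ⟩
    2 + (parity p + 2 * (offset p + block p * m)) ≡⟨ solve (parity p) (offset p) (block p * m) ⟩
    parity p + 2 * (suc (offset p) + block p * m) ≤⟨ +-monoʳ-≤ (parity p) (*-monoʳ-≤ 2 (+-monoˡ-≤ _ (offset-< p))) ⟩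
    parity p + 2 * (m + block p * m)              ∎
    where
    open ≤-Reasoning
    solve : ∀ s a W → 2 + (s + 2 * (a + W)) ≡ s + 2 * (suc a + W)
    solve = solve-∀

  offsets⇒near : ∀ {p p'} → parity p ≡ parity p' → block p ≡ block p' → offset p ≤ offset p' → Near m p p'
  offsets⇒near {p} {p'} s≡ w≡ a≤a' = e , ≤-<-trans (m∸n≤m (offset p') (offset p)) (offset-< p') , (begin
    p'                                               ≡⟨ decompose p' ⟩
    parity p' + 2 * (offset p' + block p' * m)       ≡⟨ cong₂ (λ s x → s + 2 * (x + block p' * m)) (sym s≡) (sym (m+[n∸m]≡n a≤a')) ⟩
    parity p + 2 * (offset p + e + block p' * m)     ≡⟨ cong (λ w → parity p + 2 * (offset p + e + w * m)) (sym w≡) ⟩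
    parity p + 2 * (offset p + e + block p * m)      ≡⟨ solve (parity p) (offset p) e (block p * m) ⟩
    parity p + 2 * (offset p + block p * m) + 2 * e  ≡⟨ cong (_+ 2 * e) (decompose p) ⟨
    p + 2 * e                                        ∎)
    where
    open ≡-Reasoning
    e = offset p' ∸ offset p
    solve : ∀ s a e W → s + 2 * (a + e + W) ≡ s + 2 * (a + W) + 2 * e
    solve = solve-∀

  same-block⇒near : ∀ {p p'} → parity p ≡ parity p' → block p ≡ block p' → SymClosure (Near m) p p'
  same-block⇒near {p} {p'} s≡ w≡ with ≤-total (offset p) (offset p')
  ... | inj₁ a≤a' = fwd (offsets⇒near {p} {p'} s≡ w≡ a≤a')
  ... | inj₂ a'≤a = bwd (offsets⇒near {p'} {p} (sym s≡) (sym w≡) a'≤a)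

InD3-odd : ∀ {k m q d} → isOdd k ≡ true → ¬ InD3 k m q d
InD3-odd {k} k-odd with isOdd k
InD3-odd refl | true = λ ()

module OddColouring (g m₀ q : ℕ) where

  k m K n : ℕ
  k = 5 + 2 * g
  m = suc m₀
  K = 4 + 2 * g
  n = K * m

  open Blocks m

  k-odd : isOdd k ≡ true
  k-odd = cong (_≡ᵇ 1) (trans (cong (_% 2) (solve g)) ([m+kn]%n≡m%n 1 (2 + g) 2))
    where solve : ∀ g → 5 + 2 * g ≡ 1 + (2 + g) * 2
          solve = solve-∀

  nkm≡n : nkm k m ≡ n
  nkm≡n rewrite k-odd = refl

  d2hi≡ : d2hi k m ≡ (2 + 2 * g) * m + 1
  d2hi≡ rewrite k-odd = refl

  D R : ℕ → Set
  D d = InD1 m d ⊎ InD2 k m q d ⊎ InD3 k m q d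
  R = InRange (2 * m) ((2 + 2 * g) * m + 1)

  R-hi<n : (2 + 2 * g) * m + 1 < n
  R-hi<n = subst ((2 + 2 * g) * m + 1 <_) (sym (solve g m₀)) (m≤m+n _ (2 * m₀))
    where solve : ∀ g m₀ → (4 + 2 * g) * suc m₀ ≡ suc ((2 + 2 * g) * suc m₀ + 1) + 2 * m₀
          solve = solve-∀

  D-residue : ∀ d → D d → InD1 m d ⊎ R (d % n)
  D-residue d (inj₁ d∈D1) = inj₁ d∈D1
  D-residue d (inj₂ (inj₁ (q' , _ , d∈D2))) =
    inj₂ (InRange-% q' R-hi<n (subst₂ (λ c h → InRange (2 * m + q' * c) (h + q' * c) d) nkm≡n d2hi≡ d∈D2))
  D-residue d (inj₂ (inj₂ d∈D3)) = ⊥-elim (InD3-odd k-odd d∈D3)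

  R⇒¬NearZero : ∀ {r} → R r → ¬ NearZero m n r
  R⇒¬NearZero = InRange⇒¬NearZero {m} {n} ≤-refl (≤-reflexive (solve g m))
    where solve : ∀ g m → (2 + 2 * g) * m + 1 + 2 * m ≡ (4 + 2 * g) * m + 1
          solve = solve-∀

  ¬R0 : ¬ R 0
  ¬R0 (() , _)

  code : ℕ → ℕ
  code p = parity p + 2 * block p

  colour : ℕ → Fin K
  colour p = code p mod K

  code-< : ∀ {p} → p < n → code p < K
  code-< {p} p<n = begin-strict
    parity p + 2 * block p <⟨ +-monoˡ-< (2 * block p) (parity-<2 p) ⟩
    2 + 2 * block p        ≡⟨ *-distribˡ-+ 2 1 (block p) ⟨
    2 * suc (block p)      ≤⟨ *-monoʳ-≤ 2 (block-< {p} {2 + g} (subst (p <_) (solve g m) p<n)) ⟩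
    2 * (2 + g)            ≡⟨ solve′ g ⟩
    K                      ∎
    where
    open ≤-Reasoning
    solve : ∀ g m → (4 + 2 * g) * m ≡ 2 * ((2 + g) * m)
    solve = solve-∀
    solve′ : ∀ g → 2 * (2 + g) ≡ 4 + 2 * g
    solve′ = solve-∀

  code-parity : ∀ p → code p % 2 ≡ parity p
  code-parity p = trans (%-remove-+ʳ (parity p) (m∣m*n (block p))) (m%n%n≡m%n p 2)

  same-colour⇒near : ∀ {p p'} → p < n → p' < n → colour p ≡ colour p' → SymClosure (Near m) p p'
  same-colour⇒near {p} {p'} p<n p'<n same =
    same-block⇒near parity≡ (*-cancelˡ-≡ (block p) (block p') 2 (+-cancelˡ-≡ (parity p) _ _ code≡′))
    where
    code≡ : code p ≡ code p'
    code≡ = mod-injective-< (code-< p<n) (code-< p'<n) same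
    parity≡ : parity p ≡ parity p'
    parity≡ = trans (sym (code-parity p)) (trans (cong (_% 2) code≡) (code-parity p'))
    code≡′ : parity p + 2 * block p ≡ parity p + 2 * block p'
    code≡′ = trans code≡ (cong (_+ 2 * block p') (sym parity≡))

  4m≤n : 4 * m ≤ n
  4m≤n = *-monoˡ-≤ m (m≤m+n 4 (2 * g))

  diff-safe : ∀ {p p' r} → p < n → p' < n → colour p ≡ colour p' → r < n → DiffMod n p p' r → ¬ R r × ¬ InD1 m r
  diff-safe p<n p'<n same r<n d =
    let (near0 , ¬odd) = near-diff 4m≤n r<n (same-colour⇒near p<n p'<n same) d in (λ Rr → R⇒¬NearZero Rr near0) , ¬odd

  codiff-safe : ∀ {p p' r} → p < n → p' < n → colour p ≡ colour p' → r < n → DiffMod n p' (suc p) r → ¬ R r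
  codiff-safe p<n p'<n same r<n d Rr = R⇒¬NearZero Rr (near-codiff r<n (same-colour⇒near p<n p'<n same) d)

  span : ∀ {p p'} → p < n → p' < n → colour p ≡ colour p' → p' + 2 * m ≤ p + n + 1
  span p<n p'<n same = near-span 4m≤n (same-colour⇒near p<n p'<n same)

  open Periodic n m q colour D R (≤-trans (2*m≤4*m m) 4m≤n) D-residue ¬R0 diff-safe codiff-safe span

  colourable : ∀ v → v < Nv k m q → ColorableMinus K k m q v
  colourable v v<N = deleted-circulant-colouring {D = D} ¬D0
    (subst (λ N → ProperOnPath K N D (λ i → colour (i % n))) (cong (λ c → q * c + 1) (sym nkm≡n)) periodic-proper) v<N

parity-cases : ∀ {s} → s < 2 → s ≡ 0 ⊎ s ≡ 1
parity-cases {zero} _ = inj₁ refl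
parity-cases {suc zero} _ = inj₂ refl
parity-cases {suc (suc _)} (s≤s (s≤s ()))

≢+ : ∀ {w K} x → w < K → w ≢ x + K
≢+ x w<K refl = <⇒≱ w<K (m≤n+m _ x)

module EvenColouring (g m₀ q : ℕ) where

  k m h K n : ℕ
  k = 6 + 2 * g
  m = suc m₀
  h = 2 + g
  K = 5 + 2 * g
  n = 2 * (K * m)

  open Blocks m

  -- Modulo n, D₂ is [2m, A + 2] and D₃ is [hi + 1, D3hi]; equally coloured residues of opposite
  -- parity differ by an element of [lo, hi) or its negative, and [lo, hi] is symmetric under r ↦ n + 1 − r.
  A lo hi D3lo D3hi : ℕ
  A = (2 + 2 * g) * m
  lo = A + 3
  hi = A + 6 * m₀ + 4
  D3lo = (k + 2) * m ∸ 1
  D3hi = (2 * k ∸ 4) * m + 1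

  k-even : isOdd k ≡ false
  k-even = cong (_≡ᵇ 1) (trans (cong (_% 2) (solve g)) ([m+kn]%n≡m%n 0 (3 + g) 2))
    where solve : ∀ g → 6 + 2 * g ≡ 0 + (3 + g) * 2
          solve = solve-∀

  nkm≡n : nkm k m ≡ n
  nkm≡n rewrite k-even = refl

  d2hi≡ : d2hi k m ≡ A + 2
  d2hi≡ rewrite k-even = refl

  D3lo≡ : D3lo ≡ suc hi
  D3lo≡ = cong (_∸ 1) (solve g m₀)
    where solve : ∀ g m₀ → (6 + 2 * g + 2) * suc m₀ ≡ suc (suc ((2 + 2 * g) * suc m₀ + 6 * m₀ + 4))
          solve = solve-∀

  D3hi+2m≡n+1 : D3hi + 2 * m ≡ n + 1
  D3hi+2m≡n+1 = trans (cong (λ c → (c ∸ 4) * m + 1 + 2 * m) (solve g)) (solve′ g m)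
    where solve : ∀ g → 2 * (6 + 2 * g) ≡ 4 + (8 + 4 * g)
          solve = solve-∀
          solve′ : ∀ g m → (8 + 4 * g) * m + 1 + 2 * m ≡ 2 * ((5 + 2 * g) * m) + 1
          solve′ = solve-∀

  lo+hi≡1+n : lo + hi ≡ suc n
  lo+hi≡1+n = solve g m₀
    where solve : ∀ g m₀ → (2 + 2 * g) * suc m₀ + 3 + ((2 + 2 * g) * suc m₀ + 6 * m₀ + 4) ≡ suc (2 * ((5 + 2 * g) * suc m₀))
          solve = solve-∀

  2m≤A : 2 * m ≤ A
  2m≤A = *-monoˡ-≤ m (m≤m+n 2 (2 * g))

  2m≤lo : 2 * m ≤ lo
  2m≤lo = ≤-trans 2m≤A (m≤m+n A 3)

  4m≤n : 4 * m ≤ n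
  4m≤n = subst (4 * m ≤_) (sym (solve g m)) (m≤m+n (4 * m) _)
    where solve : ∀ g m → 2 * ((5 + 2 * g) * m) ≡ 4 * m + (6 + 4 * g) * m
          solve = solve-∀

  D R : ℕ → Set
  D d = InD1 m d ⊎ InD2 k m q d ⊎ InD3 k m q d
  R r = InRange (2 * m) (A + 2) r ⊎ InRange D3lo D3hi r

  InD3-lift : ∀ {d} → InD3 k m q d → ∃[ q' ] InRange (D3lo + q' * n) (D3hi + q' * n) d
  InD3-lift {d} d∈D3 with isOdd k in k-odd | d∈D3
  ... | true  | _ = ⊥-elim (true≢false (trans (sym k-odd) k-even))
    where true≢false : true ≢ false
          true≢false ()
  ... | false | (q' , _ , d∈I) = q' , subst (λ c → InRange (D3lo + q' * c) (D3hi + q' * c) d) nkm≡n d∈I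

  D-residue : ∀ d → D d → InD1 m d ⊎ R (d % n)
  D-residue d (inj₁ d∈D1) = inj₁ d∈D1
  D-residue d (inj₂ (inj₁ (q' , _ , d∈D2))) =
    inj₂ (inj₁ (InRange-% q' D2-hi<n (subst₂ (λ c h → InRange (2 * m + q' * c) (h + q' * c) d) nkm≡n d2hi≡ d∈D2)))
    where
    D2-hi<n : A + 2 < n
    D2-hi<n = subst (A + 2 <_) (sym (solve g m₀)) (m≤m+n _ _)
      where solve : ∀ g m₀ → 2 * ((5 + 2 * g) * suc m₀) ≡ suc ((2 + 2 * g) * suc m₀ + 2) + ((2 + 2 * g) * suc m₀ + 6 * m₀ + 3)
            solve = solve-∀
  D-residue d (inj₂ (inj₂ d∈D3)) with InD3-lift d∈D3
  ... | q' , d∈I = inj₂ (inj₂ (InRange-% q' D3hi<n d∈I))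
    where
    D3hi<n : D3hi < n
    D3hi<n = +-cancelʳ-≤ 2 (suc D3hi) n (begin
      suc D3hi + 2  ≡⟨ +-suc D3hi 2 ⟨
      D3hi + 3      ≤⟨ +-monoʳ-≤ D3hi (s≤s (*-monoʳ-≤ 2 {1} {m} (s≤s z≤n))) ⟩
      D3hi + suc (2 * m) ≡⟨ +-suc D3hi (2 * m) ⟩
      suc (D3hi + 2 * m) ≡⟨ cong suc D3hi+2m≡n+1 ⟩
      suc (n + 1)   ≡⟨ +-suc n 1 ⟨
      n + 2         ∎)
      where open ≤-Reasoning

  R⇒¬NearZero : ∀ {r} → R r → ¬ NearZero m n r
  R⇒¬NearZero (inj₁ r∈D2) = InRange⇒¬NearZero {m} {n} ≤-refl (subst (A + 2 + 2 * m ≤_) (sym (solve g m₀)) (m≤m+n _ _)) r∈D2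
    where solve : ∀ g m₀ → 2 * ((5 + 2 * g) * suc m₀) + 1 ≡ (2 + 2 * g) * suc m₀ + 2 + 2 * suc m₀ + ((2 + 2 * g) * suc m₀ + 4 * m₀ + 3)
          solve = solve-∀
  R⇒¬NearZero (inj₂ r∈D3) = InRange⇒¬NearZero {m} {n} 2m≤D3lo (≤-reflexive D3hi+2m≡n+1) r∈D3
    where 2m≤D3lo = ≤-trans 2m≤A (subst (A ≤_) (sym D3lo≡) (≤-trans (m≤m+n A (6 * m₀)) (≤-trans (m≤m+n _ 4) (n≤1+n hi))))

  R⇒¬InBand : ∀ {r} → R r → ¬ InRange lo hi r
  R⇒¬InBand (inj₁ (_ , r≤A+2)) (lo≤r , _) = <⇒≱ (+-monoʳ-< A (n<1+n 2)) (≤-trans lo≤r r≤A+2)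
  R⇒¬InBand {r} (inj₂ (D3lo≤r , _)) (_ , r≤hi) = 1+n≰n (≤-trans (subst (_≤ r) D3lo≡ D3lo≤r) r≤hi)

  ¬R0 : ¬ R 0
  ¬R0 (inj₁ (() , _))
  ¬R0 (inj₂ (D3lo≤0 , _)) = 1+n≰n (≤-trans (subst (_≤ 0) D3lo≡ D3lo≤0) z≤n)

  code : ℕ → ℕ
  code p = block p + parity p * suc h

  colour : ℕ → Fin K
  colour p = code p mod K

  block<K : ∀ {p} → p < n → block p < K
  block<K {p} = block-< {p} {K}

  code-< : ∀ {p} → p < n → code p < K + K
  code-< {p} p<n = +-mono-<-≤ (block<K p<n) (begin
    parity p * suc h ≤⟨ *-monoˡ-≤ (suc h) (s≤s⁻¹ (parity-<2 p)) ⟩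
    1 * suc h        ≤⟨ subst (1 * suc h ≤_) (solve g) (m≤m+n _ _) ⟩
    K                ∎)
    where
    open ≤-Reasoning
    solve : ∀ g → 1 * (3 + g) + (2 + g) ≡ 5 + 2 * g
    solve = solve-∀

  code-even : ∀ {p} → parity p ≡ 0 → code p ≡ block p
  code-even {p} s≡0 = trans (cong (λ s → block p + s * suc h) s≡0) (+-identityʳ (block p))

  code-odd : ∀ {p} → parity p ≡ 1 → code p ≡ block p + suc h
  code-odd {p} s≡1 = trans (cong (λ s → block p + s * suc h) s≡1) (cong (block p +_) (*-identityˡ (suc h)))

  even-lower : ∀ {p} → parity p ≡ 0 → 2 * (block p * m) ≤ p
  even-lower {p} s≡0 = subst (λ s → s + 2 * (block p * m) ≤ p) s≡0 (block-lower p)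

  even-upper : ∀ {p} → parity p ≡ 0 → 2 + p ≤ 2 * (suc (block p) * m)
  even-upper {p} s≡0 = subst (λ s → 2 + p ≤ s + 2 * (suc (block p) * m)) s≡0 (block-upper p)

  odd-lower : ∀ {p} → parity p ≡ 1 → 1 + 2 * (block p * m) ≤ p
  odd-lower {p} s≡1 = subst (λ s → s + 2 * (block p * m) ≤ p) s≡1 (block-lower p)

  odd-upper : ∀ {p} → parity p ≡ 1 → suc p ≤ 2 * (suc (block p) * m)
  odd-upper {p} s≡1 = s≤s⁻¹ (subst (λ s → 2 + p ≤ s + 2 * (suc (block p) * m)) s≡1 (block-upper p))

  across-up : ∀ {p p'} → parity p ≡ 0 → parity p' ≡ 1 → block p' ≡ block p + h → Across lo hi p p'
  across-up {p} {p'} s≡0 s'≡1 w'≡ = Across-intro (begin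
      p + lo                           ≡⟨ solve₁ p A ⟩
      2 + p + (A + 1)                  ≤⟨ +-monoˡ-≤ (A + 1) (even-upper s≡0) ⟩
      2 * (suc w * m) + (A + 1)        ≡⟨ solve₂ g m₀ w ⟩
      1 + 2 * ((w + h) * m)            ≡⟨ cong (λ v → 1 + 2 * (v * m)) w'≡ ⟨
      1 + 2 * (block p' * m)           ≤⟨ odd-lower s'≡1 ⟩
      p'                               ∎)
    (begin
      suc p'                           ≤⟨ odd-upper s'≡1 ⟩
      2 * (suc (block p') * m)         ≡⟨ cong (λ v → 2 * (suc v * m)) w'≡ ⟩
      2 * (suc (w + h) * m)            ≤⟨ m≤m+n _ (2 * m₀) ⟩
      2 * (suc (w + h) * m) + 2 * m₀   ≡⟨ solve₃ g m₀ w ⟩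
      2 * (w * m) + hi                 ≤⟨ +-monoˡ-≤ hi (even-lower s≡0) ⟩
      p + hi                           ∎)
    where
    open ≤-Reasoning
    w = block p
    solve₁ : ∀ p A → p + (A + 3) ≡ 2 + p + (A + 1)
    solve₁ = solve-∀
    solve₂ : ∀ g m₀ w → 2 * (suc w * suc m₀) + ((2 + 2 * g) * suc m₀ + 1) ≡ 1 + 2 * ((w + (2 + g)) * suc m₀)
    solve₂ = solve-∀
    solve₃ : ∀ g m₀ w → 2 * (suc (w + (2 + g)) * suc m₀) + 2 * m₀ ≡ 2 * (w * suc m₀) + ((2 + 2 * g) * suc m₀ + 6 * m₀ + 4)
    solve₃ = solve-∀

  across-down : ∀ {p p'} → parity p ≡ 0 → parity p' ≡ 1 → block p ≡ block p' + suc h → Across lo hi p' p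
  across-down {p} {p'} s≡0 s'≡1 w≡ = Across-intro (begin
      p' + lo                                ≡⟨ solve₁ p' A ⟩
      suc p' + (A + 2)                       ≤⟨ +-monoˡ-≤ (A + 2) (odd-upper s'≡1) ⟩
      2 * (suc w' * m) + (A + 2)             ≤⟨ m≤m+n _ (2 * m₀) ⟩
      2 * (suc w' * m) + (A + 2) + 2 * m₀    ≡⟨ solve₂ g m₀ w' ⟩
      2 * ((w' + suc h) * m)                 ≡⟨ cong (λ v → 2 * (v * m)) w≡ ⟨
      2 * (block p * m)                      ≤⟨ even-lower s≡0 ⟩
      p                                      ∎)
    (s≤s⁻¹ (begin
      2 + p                                  ≤⟨ even-upper s≡0 ⟩
      2 * (suc (block p) * m)                ≡⟨ cong (λ v → 2 * (suc v * m)) w≡ ⟩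
      2 * (suc (w' + suc h) * m)             ≡⟨ solve₃ g m₀ w' ⟩
      suc (1 + 2 * (w' * m) + hi)            ≤⟨ s≤s (+-monoˡ-≤ hi (odd-lower s'≡1)) ⟩
      suc (p' + hi)                          ∎))
    where
    open ≤-Reasoning
    w' = block p'
    solve₁ : ∀ p A → p + (A + 3) ≡ suc p + (A + 2)
    solve₁ = solve-∀
    solve₂ : ∀ g m₀ w → 2 * (suc w * suc m₀) + ((2 + 2 * g) * suc m₀ + 2) + 2 * m₀ ≡ 2 * ((w + suc (2 + g)) * suc m₀)
    solve₂ = solve-∀
    solve₃ : ∀ g m₀ w → 2 * (suc (w + suc (2 + g)) * suc m₀) ≡ suc (1 + 2 * (w * suc m₀) + ((2 + 2 * g) * suc m₀ + 6 * m₀ + 4))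
    solve₃ = solve-∀

  cross-colour : ∀ {p p'} → p < n → p' < n → parity p ≡ 0 → parity p' ≡ 1 → code p % K ≡ code p' % K →
                 SymClosure (Across lo hi) p p'
  cross-colour {p} {p'} p<n p'<n s≡0 s'≡1 same
    with %-equal-cases (subst (_< K + K) (code-even {p} s≡0) (code-< p<n)) (subst (_< K + K) (code-odd {p'} s'≡1) (code-< p'<n))
                       (subst₂ (λ a b → a % K ≡ b % K) (code-even {p} s≡0) (code-odd {p'} s'≡1) same)
  ... | inj₁ w≡ = bwd (across-down {p} {p'} s≡0 s'≡1 w≡)
  ... | inj₂ (inj₁ w≡) = ⊥-elim (≢+ (block p' + suc h) (block<K p<n) w≡)
  ... | inj₂ (inj₂ w'+h+1≡w+K) = fwd (across-up {p} {p'} s≡0 s'≡1 (+-cancelʳ-≡ (suc h) _ _ (trans w'+h+1≡w+K (solve g (block p)))))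
    where solve : ∀ g w → w + (5 + 2 * g) ≡ w + (2 + g) + suc (2 + g)
          solve = solve-∀

  same-parity⇒near : ∀ {p p'} → p < n → p' < n → parity p ≡ parity p' → code p % K ≡ code p' % K →
                     SymClosure (Near m) p p'
  same-parity⇒near {p} {p'} p<n p'<n s≡ same = same-block⇒near s≡
    (+-%-cancelʳ (block<K p<n) (block<K p'<n) (code-< p<n) (subst (λ s → code′ s < K + K) (sym s≡) (code-< p'<n))
      (subst (λ s → code p % K ≡ code′ s % K) (sym s≡) same))
    where code′ = λ s → block p' + s * suc h

  same-colour⇒pair : ∀ {p p'} → p < n → p' < n → colour p ≡ colour p' →
                     SymClosure (Near m) p p' ⊎ SymClosure (Across lo hi) p p'
  same-colour⇒pair {p} {p'} p<n p'<n same
    with parity-cases (parity-<2 p) | parity-cases (parity-<2 p') | mod≡⇒%≡ {x = code p} {y = code p'} same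
  ... | inj₁ s≡0 | inj₂ s'≡1 | same% = inj₂ (cross-colour p<n p'<n s≡0 s'≡1 same%)
  ... | inj₂ s≡1 | inj₁ s'≡0 | same% = inj₂ (symmetric _ (cross-colour p'<n p<n s'≡0 s≡1 (sym same%)))
  ... | inj₁ s≡0 | inj₁ s'≡0 | same% = inj₁ (same-parity⇒near p<n p'<n (trans s≡0 (sym s'≡0)) same%)
  ... | inj₂ s≡1 | inj₂ s'≡1 | same% = inj₁ (same-parity⇒near p<n p'<n (trans s≡1 (sym s'≡1)) same%)

  diff-safe : ∀ {p p' r} → p < n → p' < n → colour p ≡ colour p' → r < n → DiffMod n p p' r → ¬ R r × ¬ InD1 m r
  diff-safe p<n p'<n same r<n d with same-colour⇒pair p<n p'<n same
  ... | inj₁ near = let (near0 , ¬odd) = near-diff 4m≤n r<n near d in (λ Rr → R⇒¬NearZero Rr near0) , ¬odd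
  ... | inj₂ across = (λ Rr → R⇒¬InBand Rr band) , λ odd → <⇒≱ (InD1-< odd) (≤-trans 2m≤lo (proj₁ band))
    where band = across-diff lo+hi≡1+n r<n across d

  codiff-safe : ∀ {p p' r} → p < n → p' < n → colour p ≡ colour p' → r < n → DiffMod n p' (suc p) r → ¬ R r
  codiff-safe p<n p'<n same r<n d Rr with same-colour⇒pair p<n p'<n same
  ... | inj₁ near = R⇒¬NearZero Rr (near-codiff r<n near d)
  ... | inj₂ across = R⇒¬InBand Rr (across-codiff lo+hi≡1+n 2≤lo r<n across d)
    where 2≤lo = ≤-trans (n≤1+n 2) (m≤n+m 3 A)

  span : ∀ {p p'} → p < n → p' < n → colour p ≡ colour p' → p' + 2 * m ≤ p + n + 1
  span p<n p'<n same with same-colour⇒pair p<n p'<n same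
  ... | inj₁ near = near-span 4m≤n near
  ... | inj₂ across = across-span lo+hi≡1+n {m} 2m≤lo across

  open Periodic n m q colour D R (≤-trans (2*m≤4*m m) 4m≤n) D-residue ¬R0 diff-safe codiff-safe span

  colourable : ∀ v → v < Nv k m q → ColorableMinus K k m q v
  colourable v v<N = deleted-circulant-colouring {D = D} ¬D0
    (subst (λ N → ProperOnPath K N D (λ i → colour (i % n))) (cong (λ c → q * c + 1) (sym nkm≡n)) periodic-proper) v<N

even-or-odd : ∀ n → ∃[ g ] (n ≡ 2 * g ⊎ n ≡ 1 + 2 * g)
even-or-odd zero = 0 , inj₁ refl
even-or-odd (suc n) with even-or-odd n
... | g , inj₁ refl = g , inj₂ refl
... | g , inj₂ refl = suc g , inj₁ (solve g)
  where solve : ∀ g → 2 + 2 * g ≡ 2 * suc g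
        solve = solve-∀

lemma4p2 : (k r q m : ℕ) → 5 ≤ k → 1 ≤ r → 24 * r + 12 ≤ q → 4 ∣ q → 18 * r + 2 < m →
    (v : ℕ) → v < Nv k m q → ColorableMinus (k ∸ 1) k m q v
lemma4p2 _ _ q _ (s≤s (s≤s (s≤s (s≤s (s≤s (z≤n {k₀})))))) _ _ _ (s≤s {n = m₀} _) v v<N with even-or-odd k₀
... | g , inj₁ refl = OddColouring.colourable g m₀ q v v<N
... | g , inj₂ refl = EvenColouring.colourable g m₀ q v v<N
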